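{- Let $Q$ be a query over a $\lambda$-graph $G$. Then $Q^{\Downarrow}$ is an open bisimulation if and only if $Q^{\#}$ is a sharing equivalence.
   Context: A $\lambda$-graph is a finite directed graph with application nodes $\mathrm{App}(n_1,n_2)$, abstraction nodes $\mathrm{Abs}(n)$, free variable nodes (no children) and bound variable nodes $\mathrm{Var}(l)$ with a binding edge to an abstraction node $l$, acyclic when binding edges are ignored, in which every path of child edges from a root (a node with no parents) to $\mathrm{Var}(l)$ passes through $l$. A query is a binary relation on the roots of $G$. Nodes are homogeneous if of the same kind. Rules: $\mathrm{App}(n_1,n_2)\,R\,\mathrm{App}(m_1,m_2)\Rightarrow n_1Rm_1$ and $n_2Rm_2$; $\mathrm{Abs}(n)\,R\,\mathrm{Abs}(m)\Rightarrow nRm$; (scoping) $\mathrm{Var}(n)\,R\,\mathrm{Var}(m)\Rightarrow nRm$. A bisimulation is a homogeneous relation closed under all these rules. A relation is open if it relates two free variable nodes only when they are equal. A sharing equivalence is an open bisimulation that is an equivalence relation. $Q^{\Downarrow}$ is the closure of $Q$ under the $\mathrm{App}$ and $\mathrm{Abs}$ rules; $Q^{\#}$ is the closure of $Q$ under reflexivity, symmetry, transitivity and the $\mathrm{App}$ and $\mathrm{Abs}$ rules. -}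

module Defs where

open import Data.Nat using (ℕ)
open import Data.Fin using (Fin)
open import Data.List using (List; []; _∷_)
open import Data.List.Membership.Propositional using (_∈_)
open import Data.Product using (_×_; Σ; _,_)
open import Relation.Binary.PropositionalEquality using (_≡_)
open import Relation.Binary.Core using (Rel)
open import Relation.Binary.Structures using (IsEquivalence)
open import Relation.Nullary using (¬_)
open import Level using (0ℓ)

data Node (n : ℕ) : Set where
  app  : Fin n → Fin n → Node n
  abs  : Fin n → Node n
  fvar : Node n
  var  : Fin n → Node n           -- bound variable Var(l), binding edge to l

data Kind : Set where
  kApp kAbs kFVar kVar : Kind

kind : {n : ℕ} → Node n → Kind
kind (app _ _) = kApp
kind (abs _)   = kAbs
kind fvar      = kFVar
kind (var _)   = kVar

module _ {n : ℕ} (node : Fin n → Node n) where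

  -- child edges (binding edges are NOT child edges)
  data Child : Fin n → Fin n → Set where
    child₁ : ∀ {x a b} → node x ≡ app a b → Child x a
    child₂ : ∀ {x a b} → node x ≡ app a b → Child x b
    childA : ∀ {x a}   → node x ≡ abs a   → Child x a

  -- a path of child edges from x to y, listing all visited nodes (both ends included)
  data Path : Fin n → Fin n → List (Fin n) → Set where
    here : ∀ {x} → Path x x (x ∷ [])
    step : ∀ {x y z vs} → Child x y → Path y z vs → Path x z (x ∷ vs)

  data Child⁺ : Fin n → Fin n → Set where
    one  : ∀ {x y} → Child x y → Child⁺ x y
    more : ∀ {x y z} → Child x y → Child⁺ y z → Child⁺ x z

  IsRoot : Fin n → Set
  IsRoot x = ∀ m → ¬ Child m x

record LambdaGraph (n : ℕ) : Set where
  field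
    node      : Fin n → Node n
    bindAbs   : ∀ x l → node x ≡ var l → Σ (Fin n) λ b → node l ≡ abs b
    acyclic   : ∀ x → ¬ Child⁺ node x x
    scoped    : ∀ r x l vs → IsRoot node r → node x ≡ var l →
                Path node r x vs → l ∈ vs

module _ {n : ℕ} (G : LambdaGraph n) where
  open LambdaGraph G

  Root : Fin n → Set
  Root = IsRoot node

  IsQuery : Rel (Fin n) 0ℓ → Set
  IsQuery Q = ∀ x y → Q x y → Root x × Root y

  Homogeneous : Rel (Fin n) 0ℓ → Set
  Homogeneous R = ∀ x y → R x y → kind (node x) ≡ kind (node y)

  AppClosed : Rel (Fin n) 0ℓ → Set
  AppClosed R = ∀ x y a b c d → R x y → node x ≡ app a b → node y ≡ app c d →
                R a c × R b d

  AbsClosed : Rel (Fin n) 0ℓ → Set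
  AbsClosed R = ∀ x y a c → R x y → node x ≡ abs a → node y ≡ abs c → R a c

  VarClosed : Rel (Fin n) 0ℓ → Set
  VarClosed R = ∀ x y a c → R x y → node x ≡ var a → node y ≡ var c → R a c

  IsBisimulation : Rel (Fin n) 0ℓ → Set
  IsBisimulation R = Homogeneous R × AppClosed R × AbsClosed R × VarClosed R

  IsOpen : Rel (Fin n) 0ℓ → Set
  IsOpen R = ∀ x y → R x y → node x ≡ fvar → node y ≡ fvar → x ≡ y

  IsOpenBisimulation : Rel (Fin n) 0ℓ → Set
  IsOpenBisimulation R = IsOpen R × IsBisimulation R

  IsSharingEquivalence : Rel (Fin n) 0ℓ → Set
  IsSharingEquivalence R = IsOpenBisimulation R × IsEquivalence R

  data _⇓ (Q : Rel (Fin n) 0ℓ) : Rel (Fin n) 0ℓ where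
    base  : ∀ {x y} → Q x y → (Q ⇓) x y
    appL  : ∀ {x y a b c d} → (Q ⇓) x y → node x ≡ app a b → node y ≡ app c d → (Q ⇓) a c
    appR  : ∀ {x y a b c d} → (Q ⇓) x y → node x ≡ app a b → node y ≡ app c d → (Q ⇓) b d
    absR  : ∀ {x y a c} → (Q ⇓) x y → node x ≡ abs a → node y ≡ abs c → (Q ⇓) a c

  data _# (Q : Rel (Fin n) 0ℓ) : Rel (Fin n) 0ℓ where
    base  : ∀ {x y} → Q x y → (Q #) x y
    rfl   : ∀ {x} → (Q #) x x
    sym#  : ∀ {x y} → (Q #) x y → (Q #) y x
    trans# : ∀ {x y z} → (Q #) x y → (Q #) y z → (Q #) x z
    appL  : ∀ {x y a b c d} → (Q #) x y → node x ≡ app a b → node y ≡ app c d → (Q #) a c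
    appR  : ∀ {x y a b c d} → (Q #) x y → node x ≡ app a b → node y ≡ app c d → (Q #) b d
    absR  : ∀ {x y a c} → (Q #) x y → node x ≡ abs a → node y ≡ abs c → (Q #) a c

module Submission where

-- Both Q⇓ and Q# are least closures, so each is contained in every relation
-- with the corresponding closure properties; in particular Q⇓ ⊆ Q#.
--
-- (⇒) Open bisimulations are stable under symmetric and under
-- reflexive-transitive closure, so the equivalence closure E of Q⇓ is a
-- sharing equivalence.  E contains Q and is App/Abs-closed, hence Q# ⊆ E;
-- conversely E ⊆ Q#.  Being an open bisimulation is invariant under such
-- mutual inclusion, so Q# is a sharing equivalence.
--
-- (⇐) Only the scoping rule for Q⇓ is non-trivial.  Every pair in Q⇓ is
-- reached from a pair in Q by two parallel child paths whose corresponding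
-- nodes are pairwise in Q⇓ (a "lockstep trace").  By the scoping condition
-- of the λ-graph, the binders of two Q⇓-related variables lie on these two
-- paths, and they are Q#-related.  Since a bisimulation never relates a node
-- to a strict descendant of a node equivalent to it (that would yield an
-- infinite descending chain in a finite acyclic graph), the two binders sit
-- at the same position of the trace, hence are Q⇓-related.

open import Defs
open import Data.Nat using (ℕ; zero; suc; s≤s; _<_)
open import Data.Nat.Properties using (m≤n⇒m<n∨m≡n; n<1+n)
open import Data.Fin using (Fin; toℕ)
open import Data.Fin.Properties using (pigeonhole)
open import Data.Product using (_×_; Σ; _,_; proj₁; proj₂)
open import Data.Sum using (inj₁; inj₂)
open import Data.List using (List; []; _∷_; _++_)
open import Data.List.Relation.Unary.Any using (here; there)
open import Data.List.Membership.Propositional using (_∈_)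
open import Data.Empty using (⊥; ⊥-elim)
open import Relation.Nullary using (¬_)
open import Relation.Binary.PropositionalEquality using (_≡_; refl; sym; trans; cong; subst)
open import Relation.Binary.Core using (Rel; _⇒_)
open import Relation.Binary.Structures using (IsEquivalence)
open import Relation.Binary.Construct.Closure.Symmetric using (SymClosure; fwd; bwd)
open import Relation.Binary.Construct.Closure.ReflexiveTransitive using (Star; ε; _◅_)
open import Relation.Binary.Construct.Closure.Equivalence as EqClosure using (EqClosure)
open import Level using (0ℓ)

module _ {n : ℕ} where

  appOfKind : (v : Node n) → kind v ≡ kApp → Σ (Fin n) λ c → Σ (Fin n) λ d → v ≡ app c d
  appOfKind (app c d) refl = c , d , refl

  absOfKind : (v : Node n) → kind v ≡ kAbs → Σ (Fin n) λ c → v ≡ abs c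
  absOfKind (abs c) refl = c , refl

  varOfKind : (v : Node n) → kind v ≡ kVar → Σ (Fin n) λ c → v ≡ var c
  varOfKind (var c) refl = c , refl

  fvarOfKind : (v : Node n) → kind v ≡ kFVar → v ≡ fvar
  fvarOfKind fvar refl = refl

  app-injective : ∀ {a b c d : Fin n} → app a b ≡ app c d → a ≡ c × b ≡ d
  app-injective refl = refl , refl

  abs-injective : ∀ {a c : Fin n} → abs a ≡ abs c → a ≡ c
  abs-injective refl = refl

  var-injective : ∀ {a c : Fin n} → var a ≡ var c → a ≡ c
  var-injective refl = refl

module _ {n : ℕ} (G : LambdaGraph n) where
  open LambdaGraph G

  kindVia : ∀ {x y} {v : Node n} → kind (node x) ≡ kind (node y) → node x ≡ v →
            kind (node y) ≡ kind v
  kindVia same ex = trans (sym same) (cong kind ex)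

  module _ (Q : Rel (Fin n) 0ℓ) where

    ⇓-least : ∀ {S : Rel (Fin n) 0ℓ} → AppClosed G S → AbsClosed G S → Q ⇒ S → _⇓ G Q ⇒ S
    ⇓-least appS absS Q⊆S (base q)       = Q⊆S q
    ⇓-least appS absS Q⊆S (appL p ex ey) = proj₁ (appS _ _ _ _ _ _ (⇓-least appS absS Q⊆S p) ex ey)
    ⇓-least appS absS Q⊆S (appR p ex ey) = proj₂ (appS _ _ _ _ _ _ (⇓-least appS absS Q⊆S p) ex ey)
    ⇓-least appS absS Q⊆S (absR p ex ey) = absS _ _ _ _ (⇓-least appS absS Q⊆S p) ex ey

    #-least : ∀ {S : Rel (Fin n) 0ℓ} → IsEquivalence S → AppClosed G S → AbsClosed G S →
              Q ⇒ S → _# G Q ⇒ S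
    #-least {S} eqS appS absS Q⊆S = go
      where
      module S = IsEquivalence eqS
      go : _# G Q ⇒ S
      go (base q)       = Q⊆S q
      go rfl            = S.refl
      go (sym# p)       = S.sym (go p)
      go (trans# p p′)  = S.trans (go p) (go p′)
      go (appL p ex ey) = proj₁ (appS _ _ _ _ _ _ (go p) ex ey)
      go (appR p ex ey) = proj₂ (appS _ _ _ _ _ _ (go p) ex ey)
      go (absR p ex ey) = absS _ _ _ _ (go p) ex ey

    ⇓-appClosed : AppClosed G (_⇓ G Q)
    ⇓-appClosed _ _ _ _ _ _ p ex ey = appL p ex ey , appR p ex ey

    ⇓-absClosed : AbsClosed G (_⇓ G Q)
    ⇓-absClosed _ _ _ _ p ex ey = absR p ex ey

    #-appClosed : AppClosed G (_# G Q)
    #-appClosed _ _ _ _ _ _ p ex ey = appL p ex ey , appR p ex ey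

    #-absClosed : AbsClosed G (_# G Q)
    #-absClosed _ _ _ _ p ex ey = absR p ex ey

    #-isEquivalence : IsEquivalence (_# G Q)
    #-isEquivalence = record { refl = rfl ; sym = sym# ; trans = trans# }

    ⇓⊆# : _⇓ G Q ⇒ _# G Q
    ⇓⊆# = ⇓-least #-appClosed #-absClosed base

  openBisim-⇔ : ∀ {R S : Rel (Fin n) 0ℓ} → R ⇒ S → S ⇒ R →
                IsOpenBisimulation G S → IsOpenBisimulation G R
  openBisim-⇔ R⊆S S⊆R (opS , homS , appS , absS , varS) =
      (λ x y r → opS x y (R⊆S r))
    , (λ x y r → homS x y (R⊆S r))
    , (λ x y a b c d r ex ey → let (s₁ , s₂) = appS x y a b c d (R⊆S r) ex ey in S⊆R s₁ , S⊆R s₂)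
    , (λ x y a c r ex ey → S⊆R (absS x y a c (R⊆S r) ex ey))
    , (λ x y a c r ex ey → S⊆R (varS x y a c (R⊆S r) ex ey))

  symClosure-openBisim : ∀ {R : Rel (Fin n) 0ℓ} → IsOpenBisimulation G R →
                         IsOpenBisimulation G (SymClosure R)
  symClosure-openBisim {R} (opR , homR , appClR , absClR , varClR) = op , hom , app′ , abs′ , var′
    where
    op : IsOpen G (SymClosure R)
    op x y (fwd r) ex ey = opR x y r ex ey
    op x y (bwd r) ex ey = sym (opR y x r ey ex)

    hom : Homogeneous G (SymClosure R)
    hom x y (fwd r) = homR x y r
    hom x y (bwd r) = sym (homR y x r)

    app′ : AppClosed G (SymClosure R)
    app′ x y a b c d (fwd r) ex ey = let (r₁ , r₂) = appClR x y a b c d r ex ey in fwd r₁ , fwd r₂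
    app′ x y a b c d (bwd r) ex ey = let (r₁ , r₂) = appClR y x c d a b r ey ex in bwd r₁ , bwd r₂

    abs′ : AbsClosed G (SymClosure R)
    abs′ x y a c (fwd r) ex ey = fwd (absClR x y a c r ex ey)
    abs′ x y a c (bwd r) ex ey = bwd (absClR y x c a r ey ex)

    var′ : VarClosed G (SymClosure R)
    var′ x y a c (fwd r) ex ey = fwd (varClR x y a c r ex ey)
    var′ x y a c (bwd r) ex ey = bwd (varClR y x c a r ey ex)

  -- The reflexive-transitive closure of an open bisimulation is one: along
  -- a chain all nodes have the same kind, so the rules apply step by step.
  star-openBisim : ∀ {R : Rel (Fin n) 0ℓ} → IsOpenBisimulation G R →
                   IsOpenBisimulation G (Star R)
  star-openBisim {R} (opR , homR , appClR , absClR , varClR) = op , hom , app′ , abs′ , var′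
    where
    op : IsOpen G (Star R)
    op x .x ε ex ey = refl
    op x y (_◅_ {j = m} r rs) ex ey =
      let em = fvarOfKind (node m) (kindVia (homR x m r) ex)
      in trans (opR x m r ex em) (op m y rs em ey)

    hom : Homogeneous G (Star R)
    hom x .x ε = refl
    hom x y (_◅_ {j = m} r rs) = trans (homR x m r) (hom m y rs)

    app′ : AppClosed G (Star R)
    app′ x .x a b c d ε ex ey with app-injective (trans (sym ex) ey)
    ... | refl , refl = ε , ε
    app′ x y a b c d (_◅_ {j = m} r rs) ex ey =
      let (c′ , d′ , em) = appOfKind (node m) (kindVia (homR x m r) ex)
          (r₁ , r₂)      = appClR x m a b c′ d′ r ex em
          (s₁ , s₂)      = app′ m y c′ d′ c d rs em ey
      in r₁ ◅ s₁ , r₂ ◅ s₂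

    abs′ : AbsClosed G (Star R)
    abs′ x .x a c ε ex ey with abs-injective (trans (sym ex) ey)
    ... | refl = ε
    abs′ x y a c (_◅_ {j = m} r rs) ex ey =
      let (c′ , em) = absOfKind (node m) (kindVia (homR x m r) ex)
      in absClR x m a c′ r ex em ◅ abs′ m y c′ c rs em ey

    var′ : VarClosed G (Star R)
    var′ x .x a c ε ex ey with var-injective (trans (sym ex) ey)
    ... | refl = ε
    var′ x y a c (_◅_ {j = m} r rs) ex ey =
      let (c′ , em) = varOfKind (node m) (kindVia (homR x m r) ex)
      in varClR x m a c′ r ex em ◅ var′ m y c′ c rs em ey

  eqClosure-sharingEquivalence : ∀ {R : Rel (Fin n) 0ℓ} → IsOpenBisimulation G R →
                                 IsSharingEquivalence G (EqClosure R)
  eqClosure-sharingEquivalence {R} bisim =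
    star-openBisim (symClosure-openBisim bisim) , EqClosure.isEquivalence R

  ⁺-trans : ∀ {x y z} → Child⁺ node x y → Child⁺ node y z → Child⁺ node x z
  ⁺-trans (one c)     p = more c p
  ⁺-trans (more c c⁺) p = more c (⁺-trans c⁺ p)

  pathBelowChild : ∀ {x y z a vs} → Child node x y → Path node y z vs → a ∈ vs →
                   Child⁺ node x a
  pathBelowChild c here        (here refl) = one c
  pathBelowChild c (step _ _)  (here refl) = one c
  pathBelowChild c (step c′ p) (there a∈) = more c (pathBelowChild c′ p a∈)

  -- A finite graph without child cycles has no infinite descending chain:
  -- among the first n+1 nodes of the chain two coincide (pigeonhole).
  noInfiniteDescent : (f : ℕ → Fin n) → (∀ k → Child⁺ node (f k) (f (suc k))) → ⊥
  noInfiniteDescent f down with pigeonhole (n<1+n n) (λ i → f (toℕ i))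
  ... | i , j , i<j , fi≡fj =
    acyclic (f (toℕ i)) (subst (Child⁺ node (f (toℕ i))) (sym fi≡fj) (descends _ _ i<j))
    where
    descends : ∀ i j → i < j → Child⁺ node (f i) (f j)
    descends i (suc j) (s≤s i≤j) with m≤n⇒m<n∨m≡n i≤j
    ... | inj₁ i<j  = ⁺-trans (descends i j i<j) (down j)
    ... | inj₂ refl = down i

  module _ {R : Rel (Fin n) 0ℓ} (homR : Homogeneous G R) (appClR : AppClosed G R)
           (absClR : AbsClosed G R) where

    matchChild : ∀ {u w z} → R u w → Child node u z → Σ (Fin n) λ z′ → R z z′ × Child node w z′
    matchChild {u} {w} r (child₁ eu) =
      let (c , d , ew) = appOfKind (node w) (kindVia (homR u w r) eu)
      in c , proj₁ (appClR _ _ _ _ _ _ r eu ew) , child₁ ew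
    matchChild {u} {w} r (child₂ eu) =
      let (c , d , ew) = appOfKind (node w) (kindVia (homR u w r) eu)
      in d , proj₂ (appClR _ _ _ _ _ _ r eu ew) , child₂ ew
    matchChild {u} {w} r (childA eu) =
      let (c , ew) = absOfKind (node w) (kindVia (homR u w r) eu)
      in c , absClR _ _ _ _ r eu ew , childA ew

    matchDescendant : ∀ {u w z} → R u w → Child⁺ node u z →
                      Σ (Fin n) λ z′ → R z z′ × Child⁺ node w z′
    matchDescendant r (one c) =
      let (z′ , r′ , c′) = matchChild r c in z′ , r′ , one c′
    matchDescendant r (more c c⁺) =
      let (z₁ , r₁ , c₁) = matchChild r c
          (z′ , r′ , c′) = matchDescendant r₁ c⁺
      in z′ , r′ , more c₁ c′

    record Descent : Set where
      field
        top bottom : Fin n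
        related    : R top bottom
        below      : Child⁺ node top bottom
    open Descent

    nextDescent : Descent → Descent
    nextDescent d =
      let (z′ , r′ , c′) = matchDescendant (related d) (below d)
      in record { top = bottom d ; bottom = z′ ; related = r′ ; below = c′ }

    noRelatedDescendant : ∀ {u w} → R u w → ¬ Child⁺ node u w
    noRelatedDescendant r c = noInfiniteDescent (λ k → top (descents k)) (λ k → below (descents k))
      where
      descents : ℕ → Descent
      descents zero    = record { top = _ ; bottom = _ ; related = r ; below = c }
      descents (suc k) = nextDescent (descents k)

  module _ (Q : Rel (Fin n) 0ℓ) where

    data Lockstep : Fin n → Fin n → Fin n → Fin n → List (Fin n) → List (Fin n) → Set where
      stop : ∀ {p q} → _⇓ G Q p q → Lockstep p q p q (p ∷ []) (q ∷ [])
      go   : ∀ {p q p′ q′ x y vs ws} → _⇓ G Q p q → Child node p p′ → Child node q q′ →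
             Lockstep p′ q′ x y vs ws → Lockstep p q x y (p ∷ vs) (q ∷ ws)

    extend : ∀ {p q x y x′ y′ vs ws} → Lockstep p q x y vs ws →
             Child node x x′ → Child node y y′ → _⇓ G Q x′ y′ →
             Lockstep p q x′ y′ (vs ++ x′ ∷ []) (ws ++ y′ ∷ [])
    extend (stop r)        cx cy r′ = go r cx cy (stop r′)
    extend (go r cp cq ls) cx cy r′ = go r cp cq (extend ls cx cy r′)

    leftPath : ∀ {p q x y vs ws} → Lockstep p q x y vs ws → Path node p x vs
    leftPath (stop _)       = here
    leftPath (go _ cp _ ls) = step cp (leftPath ls)

    rightPath : ∀ {p q x y vs ws} → Lockstep p q x y vs ws → Path node q y ws
    rightPath (stop _)       = here
    rightPath (go _ _ cq ls) = step cq (rightPath ls)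

    data Trace (x y : Fin n) : Set where
      trace : ∀ {r r′ vs ws} → Q r r′ → Lockstep r r′ x y vs ws → Trace x y

    traceOf : ∀ {x y} → _⇓ G Q x y → Trace x y
    traceOf p@(base q) = trace q (stop p)
    traceOf p@(appL p′ ex ey) with traceOf p′
    ... | trace q ls = trace q (extend ls (child₁ ex) (child₁ ey) p)
    traceOf p@(appR p′ ex ey) with traceOf p′
    ... | trace q ls = trace q (extend ls (child₂ ex) (child₂ ey) p)
    traceOf p@(absR p′ ex ey) with traceOf p′
    ... | trace q ls = trace q (extend ls (childA ex) (childA ey) p)

    -- If Q# is a bisimulation, Q#-related nodes on lockstep paths are at the
    -- same position, hence Q⇓-related.
    module _ (hom# : Homogeneous G (_# G Q)) where

      aligned : ∀ {p q x y vs ws a c} → Lockstep p q x y vs ws → a ∈ vs → c ∈ ws →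
                _# G Q a c → _⇓ G Q a c
      aligned (stop r)        (here refl) (here refl) _ = r
      aligned (go r _ _ _)    (here refl) (here refl) _ = r
      aligned (go _ _ _ ls)   (there a∈)  (there c∈)  s = aligned ls a∈ c∈ s
      aligned (go r _ cq ls)  (here refl) (there c∈)  s =
        ⊥-elim (noRelatedDescendant hom# (#-appClosed Q) (#-absClosed Q)
                  (trans# (sym# (⇓⊆# Q r)) s) (pathBelowChild cq (rightPath ls) c∈))
      aligned (go r cp _ ls)  (there a∈)  (here refl) s =
        ⊥-elim (noRelatedDescendant hom# (#-appClosed Q) (#-absClosed Q)
                  (trans# (⇓⊆# Q r) (sym# s)) (pathBelowChild cp (leftPath ls) a∈))
      aligned (stop _)        (there ())  _           _
      aligned (stop _)        (here refl) (there ())  _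

      -- The scoping rule for Q⇓: the binders lie on the two lockstep paths
      -- from the roots, and they are Q#-related.
      ⇓-varClosed : IsQuery G Q → VarClosed G (_# G Q) → VarClosed G (_⇓ G Q)
      ⇓-varClosed isQ var# x y a c p ex ey with traceOf p
      ... | trace {r} {r′} q ls =
        aligned ls (scoped r x a _ (proj₁ (isQ r r′ q)) ex (leftPath ls))
                   (scoped r′ y c _ (proj₂ (isQ r r′ q)) ey (rightPath ls))
                   (var# x y a c (⇓⊆# Q p) ex ey)

mainTheorem14 : ∀ {n : ℕ} (G : LambdaGraph n) (Q : Rel (Fin n) 0ℓ) →
    IsQuery G Q →
    (IsOpenBisimulation G (_⇓ G Q) → IsSharingEquivalence G (_# G Q)) ×
    (IsSharingEquivalence G (_# G Q) → IsOpenBisimulation G (_⇓ G Q))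
mainTheorem14 G Q isQ = sharing , openBisim
  where
  sharing : IsOpenBisimulation G (_⇓ G Q) → IsSharingEquivalence G (_# G Q)
  sharing bisim⇓ with eqClosure-sharingEquivalence G bisim⇓
  ... | E-bisim@(_ , _ , appE , absE , _) , E-equiv =
    openBisim-⇔ G #⊆E E⊆# E-bisim , #-isEquivalence G Q
    where
    #⊆E : _# G Q ⇒ EqClosure (_⇓ G Q)
    #⊆E = #-least G Q E-equiv appE absE (λ q → fwd (base q) ◅ ε)

    E⊆# : EqClosure (_⇓ G Q) ⇒ _# G Q
    E⊆# = EqClosure.fold (#-isEquivalence G Q) (⇓⊆# G Q)

  openBisim : IsSharingEquivalence G (_# G Q) → IsOpenBisimulation G (_⇓ G Q)
  openBisim ((op# , hom# , _ , _ , var#) , _) =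
      (λ x y p → op# x y (⇓⊆# G Q p))
    , (λ x y p → hom# x y (⇓⊆# G Q p))
    , ⇓-appClosed G Q
    , ⇓-absClosed G Q
    , ⇓-varClosed G Q hom# isQ var#
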